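{- Let $n \ge 1$, let $\pi$ be a permutation of $\{1, \ldots, n^2\}$ and let $x = (x_1, \ldots, x_{n^2})^T \in \mathbb{Z}^{n^2}$. The following are equivalent: (i) $A_\pi x <> \mathbf{0}$ and $1 \le x_i \le n$ for $i = 1, \ldots, n^2$; (ii) $\{x_i \mid i \in cs_\pi(j)\} = \{1, \ldots, n\}$ for $j = 1, \ldots, n$.
   Context: For $y \in \mathbb{Z}^s$ write $y <> \mathbf{0}$ if every component of $y$ is nonzero. Let $s(n) = \sum_{i=1}^{n-1} i$. The $s(n) \times n$ matrix $A(n)$ is defined inductively: $A(1)$ is the empty matrix, and $A(n) = \begin{pmatrix} \mathbf{1}_{n-1} & -U_{n-1} \\ \mathbf{0}_{s(n-1)} & A(n-1) \end{pmatrix}$, where $\mathbf{1}_{n-1}$ is the all-ones column of length $n-1$, $U_{n-1}$ is the identity matrix and $\mathbf{0}_{s(n-1)}$ is the zero column of length $s(n-1)$. Let $A$ be the $(n \cdot s(n)) \times n^2$ block-diagonal matrix whose $n$ diagonal blocks all equal $A(n)$. For a permutation $\pi$ of $\{1,\ldots,n^2\}$, $A_\pi$ denotes the matrix whose $j$-th column is the $\pi^{ -1}(j)$-th column of $A$. The constraint sets of $\pi$ are $cs_\pi(j) = \{\pi(i) \mid (j-1)n + 1 \le i \le jn\}$ for $j = 1, \ldots, n$. -}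

module Defs where

open import Data.Nat as ℕ using (ℕ; zero; suc)
open import Data.Integer as ℤ using (ℤ; +_; -_; _≤_)
open import Data.Fin as Fin using (Fin; zero; suc; splitAt; remQuot; combine)
open import Data.Fin.Permutation using (Permutation′; _⟨$⟩ʳ_; _⟨$⟩ˡ_)
open import Data.Sum using (inj₁; inj₂)
open import Data.Product using (_,_; _×_; ∃-syntax)
open import Data.Bool using (if_then_else_)
open import Relation.Nullary.Decidable using (⌊_⌋)
open import Relation.Binary.PropositionalEquality using (_≡_; _≢_)

Matrix : ℕ → ℕ → Set
Matrix m k = Fin m → Fin k → ℤ

-- s(n) = Σ_{i=1}^{n-1} i  (so s(n+1) = n + s(n), s(0) = s(1) = 0)
s : ℕ → ℕ
s zero    = 0
s (suc n) = n ℕ.+ s n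

-- A(n), defined inductively:
-- A(n+1) = ( 1_n      -U_n )
--          ( 0_{s(n)}  A(n) )
-- rows of A(n+1) are Fin (n + s n): the first n rows form the top block.
Amat : (n : ℕ) → Matrix (s n) n
Amat zero    ()
Amat (suc n) r c with splitAt n r
Amat (suc n) r zero    | inj₁ i = + 1
Amat (suc n) r (suc c) | inj₁ i = if ⌊ c Fin.≟ i ⌋ then - (+ 1) else + 0
Amat (suc n) r zero    | inj₂ i = + 0
Amat (suc n) r (suc c) | inj₂ i = Amat n i c

-- Row index Fin (n * s n) is split as (block, row in block), column index
-- Fin (n * n) as (block, column in block), blocks of consecutive indices.
Ablock : (n : ℕ) → Matrix (n ℕ.* s n) (n ℕ.* n)
Ablock n r c with remQuot {n} (s n) r | remQuot {n} n c
... | b , r′ | b′ , c′ = if ⌊ b Fin.≟ b′ ⌋ then Amat n r′ c′ else + 0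

Aπ : (n : ℕ) → Permutation′ (n ℕ.* n) → Matrix (n ℕ.* s n) (n ℕ.* n)
Aπ n π r j = Ablock n r (π ⟨$⟩ˡ j)

sumFin : (m : ℕ) → (Fin m → ℤ) → ℤ
sumFin zero    f = + 0
sumFin (suc m) f = f zero ℤ.+ sumFin m (λ i → f (suc i))

_·_ : {m k : ℕ} → Matrix m k → (Fin k → ℤ) → Fin m → ℤ
_·_ {m} {k} M x r = sumFin k (λ c → M r c ℤ.* x c)

AllNonzero : {m : ℕ} → (Fin m → ℤ) → Set
AllNonzero y = ∀ r → y r ≢ + 0

-- membership in the constraint set cs_π(j) = { π(i) | i in the j-th block of n
-- consecutive indices } (0-indexed: i = j*n + k, k < n)
InCS : (n : ℕ) → Permutation′ (n ℕ.* n) → Fin n → Fin (n ℕ.* n) → Set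
InCS n π j i = ∃[ k ] (π ⟨$⟩ʳ combine {n} {n} j k) ≡ i

module Submission where

-- Write z_j k = x(π(j,k)) for the entries of x on cs_π(j), where
-- (j,k) ↦ j·n + k enumerates Fin (n·n) block by block. Undoing the column
-- permutation and splitting rows and columns into blocks, A_π x decomposes
-- into the n independent products A(n) z_j. By the recursive shape of A(n)
-- its rows compute exactly the differences z_a - z_b (a < b), so
-- A(n) z <> 0 iff z is injective. Finally, by pigeonhole a map from Fin n
-- into the n-element interval [1,n] is injective iff it covers [1,n]; so
-- both (i) and (ii) say that every z_j is a bijection onto [1,n].

open import Defs
open import Data.Nat using (ℕ; _*_)
open import Data.Integer using (ℤ; +_; _≤_)
open import Data.Fin using (Fin)
open import Data.Fin.Permutation using (Permutation′)
open import Data.Product using (_×_; ∃-syntax)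
open import Function.Bundles using (_⇔_)
open import Relation.Binary.PropositionalEquality using (_≡_)

open import Data.Nat using (zero; suc; s≤s; z≤n)
import Data.Nat as ℕ
open import Data.Integer using (_-_; 0ℤ; -1ℤ; +≤+)
import Data.Integer as ℤ
import Data.Integer.Properties as ℤP
import Data.Nat.Properties as ℕP
open import Data.Fin using (zero; suc; _↑ˡ_; _↑ʳ_; splitAt; combine; remQuot; toℕ; fromℕ<; punchOut; _≟_)
import Data.Fin.Properties as FinP
open import Data.Fin.Permutation using (_⟨$⟩ʳ_; _⟨$⟩ˡ_; inverseˡ; inverseʳ)
open import Data.Product using (_,_; proj₁; proj₂; ∃)
open import Data.Sum using (inj₁; inj₂)
open import Data.Bool using (if_then_else_)
open import Relation.Nullary using (yes; no; contradiction)
open import Relation.Nullary.Decidable using (⌊_⌋)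
open import Relation.Binary.PropositionalEquality
  using (refl; sym; trans; cong; cong₂; subst; _≢_; module ≡-Reasoning)
open import Function using (_∘_)
open import Function.Bundles using (mk⇔; Equivalence)
open import Function.Definitions using (Injective)
import Algebra.Properties.CommutativeMonoid.Sum as MonoidSum

open ≡-Reasoning

select-refl : ∀ {m} {A : Set} {u w : A} (a : Fin m) → (if ⌊ a ≟ a ⌋ then u else w) ≡ u
select-refl a with a ≟ a
... | yes _  = refl
... | no a≢a = contradiction refl a≢a

select-≢ : ∀ {m} {A : Set} {u w : A} {a b : Fin m} → a ≢ b → (if ⌊ a ≟ b ⌋ then u else w) ≡ w
select-≢ {a = a} {b} a≢b with a ≟ b
... | yes a≡b = contradiction a≡b a≢b
... | no _    = refl

sumFin-cong : ∀ m {f g : Fin m → ℤ} → (∀ i → f i ≡ g i) → sumFin m f ≡ sumFin m g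
sumFin-cong zero    f≗g = refl
sumFin-cong (suc m) f≗g = cong₂ ℤ._+_ (f≗g zero) (sumFin-cong m (f≗g ∘ suc))

sumFin-zero : ∀ m {f : Fin m → ℤ} → (∀ i → f i ≡ 0ℤ) → sumFin m f ≡ 0ℤ
sumFin-zero zero    f≗0 = refl
sumFin-zero (suc m) f≗0 = cong₂ ℤ._+_ (f≗0 zero) (sumFin-zero m (f≗0 ∘ suc))

sumFin-single : ∀ m {f : Fin m → ℤ} (i : Fin m) → (∀ j → j ≢ i → f j ≡ 0ℤ) → sumFin m f ≡ f i
sumFin-single (suc m) {f} zero    off = begin
  f zero ℤ.+ sumFin m (f ∘ suc) ≡⟨ cong (λ t → f zero ℤ.+ t) (sumFin-zero m (λ j → off (suc j) (λ ()))) ⟩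
  f zero ℤ.+ 0ℤ                 ≡⟨ ℤP.+-identityʳ (f zero) ⟩
  f zero                        ∎
sumFin-single (suc m) {f} (suc i) off = begin
  f zero ℤ.+ sumFin m (f ∘ suc) ≡⟨ cong (ℤ._+ sumFin m (f ∘ suc)) (off zero (λ ())) ⟩
  0ℤ ℤ.+ sumFin m (f ∘ suc)     ≡⟨ ℤP.+-identityˡ _ ⟩
  sumFin m (f ∘ suc)            ≡⟨ sumFin-single m i (λ j j≢i → off (suc j) (j≢i ∘ FinP.suc-injective)) ⟩
  f (suc i)                     ∎

sumFin-split : ∀ k l (f : Fin (k ℕ.+ l) → ℤ) →
  sumFin (k ℕ.+ l) f ≡ sumFin k (λ i → f (i ↑ˡ l)) ℤ.+ sumFin l (λ i → f (k ↑ʳ i))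
sumFin-split zero    l f = sym (ℤP.+-identityˡ _)
sumFin-split (suc k) l f = trans (cong (λ t → f zero ℤ.+ t) (sumFin-split k l (f ∘ suc)))
                                 (sym (ℤP.+-assoc (f zero) _ _))

sumFin-combine : ∀ m k (f : Fin (m * k) → ℤ) →
  sumFin (m * k) f ≡ sumFin m (λ b → sumFin k (λ j → f (combine b j)))
sumFin-combine zero    k f = refl
sumFin-combine (suc m) k f = trans (sumFin-split k (m * k) f)
  (cong (λ t → sumFin k (λ j → f (j ↑ˡ (m * k))) ℤ.+ t) (sumFin-combine m k (λ i → f (k ↑ʳ i))))

module ℤSum = MonoidSum ℤP.+-0-commutativeMonoid

sumFin≡sum : ∀ m (f : Fin m → ℤ) → sumFin m f ≡ ℤSum.sum f
sumFin≡sum zero    f = refl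
sumFin≡sum (suc m) f = cong (λ t → f zero ℤ.+ t) (sumFin≡sum m (f ∘ suc))

sumFin-permute : ∀ m (π : Permutation′ m) (f : Fin m → ℤ) →
  sumFin m f ≡ sumFin m (λ i → f (π ⟨$⟩ʳ i))
sumFin-permute m π f = begin
  sumFin m f                    ≡⟨ sumFin≡sum m f ⟩
  ℤSum.sum f                    ≡⟨ ℤSum.sum-permute f π ⟩
  ℤSum.sum (f ∘ (π ⟨$⟩ʳ_))      ≡⟨ sumFin≡sum m _ ⟨
  sumFin m (λ i → f (π ⟨$⟩ʳ i)) ∎

-- An injective endomap of Fin n is surjective: if y were missed, punching
-- y out of the codomain would inject Fin (suc m) into Fin m.
injective⇒surjective : ∀ {n} (f : Fin n → Fin n) → Injective _≡_ _≡_ f → ∀ y → ∃ λ k → f k ≡ y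
injective⇒surjective {suc m} f f-inj y with FinP.any? (λ k → f k ≟ y)
... | yes hit = hit
... | no miss = contradiction (FinP.injective⇒≤ punched-inj) ℕP.1+n≰n
  where
  y≢f : ∀ k → y ≢ f k
  y≢f k y≡fk = miss (k , sym y≡fk)
  punched : Fin (suc m) → Fin m
  punched k = punchOut (y≢f k)
  punched-inj : Injective _≡_ _≡_ punched
  punched-inj {a} {b} = f-inj ∘ FinP.punchOut-injective (y≢f a) (y≢f b)

-- A surjective endomap of Fin n is injective: a chosen section g is
-- injective, hence surjective, which makes it a two-sided inverse of f.
surjective⇒injective : ∀ {n} (f : Fin n → Fin n) → (∀ y → ∃ λ k → f k ≡ y) → Injective _≡_ _≡_ f
surjective⇒injective {n} f f-onto {a} {b} fa≡fb = begin
  a         ≡⟨ g∘f a ⟨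
  g (f a)   ≡⟨ cong g fa≡fb ⟩
  g (f b)   ≡⟨ g∘f b ⟩
  b         ∎
  where
  g : Fin n → Fin n
  g y = proj₁ (f-onto y)
  f∘g : ∀ y → f (g y) ≡ y
  f∘g y = proj₂ (f-onto y)
  g-inj : Injective _≡_ _≡_ g
  g-inj {y} {y′} gy≡gy′ = trans (sym (f∘g y)) (trans (cong f gy≡gy′) (f∘g y′))
  g∘f : ∀ a → g (f a) ≡ a
  g∘f a with a′ , ga′≡a ← injective⇒surjective g g-inj a =
    trans (cong (g ∘ f) (sym ga′≡a)) (trans (cong g (f∘g a′)) ga′≡a)

InRange : ℕ → ℤ → Set
InRange n v = (+ 1 ≤ v) × (v ≤ + n)

Covers : ∀ n → (Fin n → ℤ) → Set
Covers n z = ∀ v → InRange n v → ∃ λ k → z k ≡ v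

toInt : ∀ {n} → Fin n → ℤ
toInt k = + suc (toℕ k)

toInt-injective : ∀ {n} → Injective _≡_ _≡_ (toInt {n})
toInt-injective = FinP.toℕ-injective ∘ ℕP.suc-injective ∘ ℤP.+-injective

toInt-inRange : ∀ {n} (k : Fin n) → InRange n (toInt k)
toInt-inRange k = +≤+ (s≤s z≤n) , +≤+ (FinP.toℕ<n k)

toInt-covers : ∀ n → Covers n toInt
toInt-covers n (+ zero)    (+≤+ () , _)
toInt-covers n (+ suc m)   (_ , +≤+ m<n) = fromℕ< m<n , cong (+_ ∘ suc) (FinP.toℕ-fromℕ< m<n)
toInt-covers n ℤ.-[1+ m ] (() , _)

-- Pigeonhole for maps Fin n → [1,n]: injective iff covering. Such a map
-- factors as toInt ∘ index, reducing both directions to Fin n → Fin n.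
module _ {n} (z : Fin n → ℤ) (z∈ : ∀ k → InRange n (z k)) where
  private
    index : Fin n → Fin n
    index k = proj₁ (toInt-covers n (z k) (z∈ k))
    toInt∘index : ∀ k → toInt (index k) ≡ z k
    toInt∘index k = proj₂ (toInt-covers n (z k) (z∈ k))
    index-injective : Injective _≡_ _≡_ z → Injective _≡_ _≡_ index
    index-injective z-inj {a} {b} e =
      z-inj (trans (sym (toInt∘index a)) (trans (cong toInt e) (toInt∘index b)))

  injective⇒covers : Injective _≡_ _≡_ z → Covers n z
  injective⇒covers z-inj v v∈
    with y , toInt-y≡v ← toInt-covers n v v∈
    with k , index-k≡y ← injective⇒surjective index (index-injective z-inj) y =
    k , trans (sym (toInt∘index k)) (trans (cong toInt index-k≡y) toInt-y≡v)

  covers⇒injective : Covers n z → Injective _≡_ _≡_ z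
  covers⇒injective z-covers {a} {b} za≡zb = surjective⇒injective index index-onto
    (toInt-injective (trans (toInt∘index a) (trans za≡zb (sym (toInt∘index b)))))
    where
    index-onto : ∀ y → ∃ λ k → index k ≡ y
    index-onto y with k , zk≡y ← z-covers (toInt y) (toInt-inRange y) =
      k , toInt-injective (trans (toInt∘index k) zk≡y)

row-top : ∀ n i (z : Fin (suc n) → ℤ) → (Amat (suc n) · z) (i ↑ˡ s n) ≡ z zero - z (suc i)
row-top n i z rewrite FinP.splitAt-↑ˡ n i (s n) =
  cong₂ ℤ._+_ (ℤP.*-identityˡ (z zero))
              (trans (sumFin-single n i off) (trans on (ℤP.-1*i≡-i (z (suc i)))))
  where
  entry : Fin n → ℤ
  entry c = if ⌊ c ≟ i ⌋ then -1ℤ else 0ℤ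
  off : ∀ c → c ≢ i → entry c ℤ.* z (suc c) ≡ 0ℤ
  off c c≢i = trans (cong (ℤ._* z (suc c)) (select-≢ c≢i)) (ℤP.*-zeroˡ (z (suc c)))
  on : entry i ℤ.* z (suc i) ≡ -1ℤ ℤ.* z (suc i)
  on = cong (ℤ._* z (suc i)) (select-refl i)

row-bottom : ∀ n i (z : Fin (suc n) → ℤ) → (Amat (suc n) · z) (n ↑ʳ i) ≡ (Amat n · (z ∘ suc)) i
row-bottom n i z rewrite FinP.splitAt-↑ʳ n (s n) i = ℤP.+-identityˡ _

nonzero⇒injective : ∀ n (z : Fin n → ℤ) → AllNonzero (Amat n · z) → Injective _≡_ _≡_ z
nonzero⇒injective zero    z nz {()}
nonzero⇒injective (suc n) z nz = separate
  where
  z₀≢ : ∀ i → z zero ≢ z (suc i)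
  z₀≢ i e = nz (i ↑ˡ s n) (trans (row-top n i z) (ℤP.i≡j⇒i-j≡0 e))
  tail-inj : Injective _≡_ _≡_ (z ∘ suc)
  tail-inj = nonzero⇒injective n (z ∘ suc) (λ i e → nz (n ↑ʳ i) (trans (row-bottom n i z) e))
  separate : Injective _≡_ _≡_ z
  separate {zero}  {zero}  _ = refl
  separate {zero}  {suc j} e = contradiction e (z₀≢ j)
  separate {suc i} {zero}  e = contradiction (sym e) (z₀≢ i)
  separate {suc i} {suc j} e = cong suc (tail-inj e)

↑-cases : ∀ m k {P : Fin (m ℕ.+ k) → Set} → (∀ i → P (i ↑ˡ k)) → (∀ i → P (m ↑ʳ i)) → ∀ r → P r
↑-cases m k {P} first second r with splitAt m r in eq
... | inj₁ i = subst P (FinP.splitAt⁻¹-↑ˡ eq) (first i)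
... | inj₂ i = subst P (FinP.splitAt⁻¹-↑ʳ eq) (second i)

injective⇒nonzero : ∀ n (z : Fin n → ℤ) → Injective _≡_ _≡_ z → AllNonzero (Amat n · z)
injective⇒nonzero (suc n) z z-inj = ↑-cases n (s n) top bottom
  where
  top : ∀ i → (Amat (suc n) · z) (i ↑ˡ s n) ≢ 0ℤ
  top i e = contradiction (z-inj (ℤP.i-j≡0⇒i≡j _ _ (trans (sym (row-top n i z)) e))) λ ()
  bottom : ∀ i → (Amat (suc n) · z) (n ↑ʳ i) ≢ 0ℤ
  bottom i e = injective⇒nonzero n (z ∘ suc) (FinP.suc-injective ∘ z-inj) i
                 (trans (sym (row-bottom n i z)) e)

permuteColumns : ∀ {m k} (M : Matrix m k) (π : Permutation′ k) (x : Fin k → ℤ) r →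
  ((λ r j → M r (π ⟨$⟩ˡ j)) · x) r ≡ (M · (λ c → x (π ⟨$⟩ʳ c))) r
permuteColumns {k = k} M π x r = begin
  sumFin k (λ j → M r (π ⟨$⟩ˡ j) ℤ.* x j)
    ≡⟨ sumFin-permute k π _ ⟩
  sumFin k (λ c → M r (π ⟨$⟩ˡ (π ⟨$⟩ʳ c)) ℤ.* x (π ⟨$⟩ʳ c))
    ≡⟨ sumFin-cong k (λ c → cong (λ t → M r t ℤ.* x (π ⟨$⟩ʳ c)) (inverseˡ π)) ⟩
  sumFin k (λ c → M r c ℤ.* x (π ⟨$⟩ʳ c))
    ∎

combine-cases : ∀ m k {P : Fin (m * k) → Set} → (∀ j k → P (combine j k)) → ∀ r → P r
combine-cases m k {P} h r =
  subst P (FinP.combine-remQuot {m} k r) (h (proj₁ (remQuot {m} k r)) (proj₂ (remQuot {m} k r)))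

Ablock-entry : ∀ n b r′ b′ k →
  Ablock n (combine b r′) (combine b′ k) ≡ (if ⌊ b ≟ b′ ⌋ then Amat n r′ k else 0ℤ)
Ablock-entry n b r′ b′ k = cong₂ entry (FinP.remQuot-combine b r′) (FinP.remQuot-combine b′ k)
  where
  entry : Fin n × Fin (s n) → Fin n × Fin n → ℤ
  entry (b , r′) (b′ , k) = if ⌊ b ≟ b′ ⌋ then Amat n r′ k else 0ℤ

Ablock-row : ∀ n (y : Fin (n * n) → ℤ) b r′ →
  (Ablock n · y) (combine b r′) ≡ (Amat n · (λ k → y (combine b k))) r′
Ablock-row n y b r′ = begin
  sumFin (n * n) (λ c → Ablock n r c ℤ.* y c)
    ≡⟨ sumFin-combine n n _ ⟩
  sumFin n (λ b′ → sumFin n (λ k → Ablock n r (combine b′ k) ℤ.* y (combine b′ k)))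
    ≡⟨ sumFin-single n b off-diagonal ⟩
  sumFin n (λ k → Ablock n r (combine b k) ℤ.* y (combine b k))
    ≡⟨ sumFin-cong n (λ k → cong (ℤ._* y (combine b k)) (trans (Ablock-entry n b r′ b k) (select-refl b))) ⟩
  sumFin n (λ k → Amat n r′ k ℤ.* y (combine b k))
    ∎
  where
  r = combine b r′
  off-diagonal : ∀ b′ → b′ ≢ b → sumFin n (λ k → Ablock n r (combine b′ k) ℤ.* y (combine b′ k)) ≡ 0ℤ
  off-diagonal b′ b′≢b = sumFin-zero n λ k →
    trans (cong (ℤ._* y (combine b′ k)) (trans (Ablock-entry n b r′ b′ k) (select-≢ (b′≢b ∘ sym))))
          (ℤP.*-zeroˡ (y (combine b′ k)))

module _ (n : ℕ) (π : Permutation′ (n * n)) (x : Fin (n * n) → ℤ) where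

  csEntries : Fin n → Fin n → ℤ
  csEntries j k = x (π ⟨$⟩ʳ combine j k)

  Aπ-block : ∀ j r′ → (Aπ n π · x) (combine j r′) ≡ (Amat n · csEntries j) r′
  Aπ-block j r′ = trans (permuteColumns (Ablock n) π x (combine j r′))
                        (Ablock-row n (λ c → x (π ⟨$⟩ʳ c)) j r′)

  Aπ-nonzero⇒ : AllNonzero (Aπ n π · x) → ∀ j → AllNonzero (Amat n · csEntries j)
  Aπ-nonzero⇒ nz j r′ e = nz (combine j r′) (trans (Aπ-block j r′) e)

  ⇒Aπ-nonzero : (∀ j → AllNonzero (Amat n · csEntries j)) → AllNonzero (Aπ n π · x)
  ⇒Aπ-nonzero nz = combine-cases n (s n) λ j r′ e → nz j r′ (trans (sym (Aπ-block j r′)) e)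

  -- The constraint sets cover all indices: i = π(j,k) for (j,k) the block
  -- position of π⁻¹(i). So bounds on all z_j give bounds on x.
  csEntries-inRange⇒ : (∀ j k → InRange n (csEntries j k)) → ∀ i → InRange n (x i)
  csEntries-inRange⇒ z∈ i =
    subst (InRange n ∘ x) (inverseʳ π) (combine-cases n n {InRange n ∘ x ∘ (π ⟨$⟩ʳ_)} z∈ (π ⟨$⟩ˡ i))

  Condition-i : Set
  Condition-i = AllNonzero (Aπ n π · x) × (∀ i → InRange n (x i))

  Condition-ii : Set
  Condition-ii = ∀ j v → (∃[ i ] (InCS n π j i × x i ≡ v)) ⇔ InRange n v

  -- (i) ⇒ (ii): each z_j is injective by the rows of A(n), hence covers [1,n].
  i⇒ii : Condition-i → Condition-ii
  i⇒ii (nz , x∈) j v = mk⇔ (λ { (i , _ , refl) → x∈ i }) λ v∈ →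
    let k , zk≡v = injective⇒covers (csEntries j) (λ k → x∈ (π ⟨$⟩ʳ combine j k))
                     (nonzero⇒injective n (csEntries j) (Aπ-nonzero⇒ nz j)) v v∈
    in _ , (k , refl) , zk≡v

  -- (ii) ⇒ (i): each z_j lies in [1,n] and covers it, hence is injective.
  ii⇒i : Condition-ii → Condition-i
  ii⇒i cs = ⇒Aπ-nonzero (λ j → injective⇒nonzero n (csEntries j)
                                  (covers⇒injective (csEntries j) (z∈ j) (covers j)))
          , csEntries-inRange⇒ z∈
    where
    z∈ : ∀ j k → InRange n (csEntries j k)
    z∈ j k = Equivalence.to (cs j (csEntries j k)) (_ , (k , refl) , refl)
    covers : ∀ j → Covers n (csEntries j)
    covers j v v∈ with i , (k , refl) , e ← Equivalence.from (cs j v) v∈ = k , e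

-- The two conditions are equivalent.
lemma3p5 : (n : ℕ) → 1 Data.Nat.≤ n → (π : Permutation′ (n * n)) → (x : Fin (n * n) → ℤ) →
    (AllNonzero (Aπ n π · x) × (∀ i → (+ 1 ≤ x i) × (x i ≤ + n)))
    ⇔ (∀ (j : Fin n) (v : ℤ) → (∃[ i ] (InCS n π j i × x i ≡ v)) ⇔ ((+ 1 ≤ v) × (v ≤ + n)))
lemma3p5 n _ π x = mk⇔ (i⇒ii n π x) (ii⇒i n π x)
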